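{- Let $\mathfrak F=(X,R,E)$ be an $\mathbf{MK}$-frame with Kripke bundle $\mathscr B(\mathfrak F)=((X,R),\pi,(X/E,R_0))$. (1) For every valuation $v$ on $\mathfrak F$ there is a valuation $I$ on $\mathscr B(\mathfrak F)$ such that for every $\mathcal{L}_\exists$-formula $\varphi$ and every $a\in X$: $\pi(a)\models_I\varphi^t[a/x]$ iff $a\models_v\varphi$. (2) For every valuation $I$ on $\mathscr B(\mathfrak F)$ there is a valuation $v$ on $\mathfrak F$ such that for every $\mathcal{L}_\exists$-formula $\varphi$ and every $a\in X$: $\pi(a)\models_I\varphi^t[a/x]$ iff $a\models_v\varphi$.
   Context: An $\mathbf{MK}$-frame is $(X,R,E)$, $X\neq\varnothing$, $R\subseteq X^2$, $E$ an equivalence relation, with $x\mathrel Ey$, $y\mathrel Rz$ implying $x\mathrel Ru$, $u\mathrel Ez$ for some $u$; a valuation $v$ maps letters to subsets of $X$, and $\mathcal{L}_\exists$-formulas (letters, $\neg,\vee,\Diamond,\exists$) are evaluated with $\Diamond$ via $R$ and $\exists$ via $E$. $\pi$ is the quotient map $X\to X/E$ and $[x]\mathrel{R_0}[y]$ iff $x\mathrel Rz$, $z\mathrel Ey$ for some $z$. The translation $(-)^t$ fixes a variable $x$ and unary predicates $p^*$: $p^t=p^*(x)$, commutes with $\neg,\vee,\Diamond$, $(\exists\varphi)^t=\exists x\varphi^t$. A valuation $I$ on the bundle assigns to each unary (more generally $m$-ary) predicate $P$ and world $w\in X/E$ a set $I_w(P)\subseteq(\pi^{ -1}(w))^m$;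 at $w$, $w\models_I P(\vec a)$ iff $\vec a\in I_w(P)$, Boolean clauses are classical, $w\models_I\exists x\psi$ iff $w\models_I\psi[b/x]$ for some $b\in\pi^{ -1}(w)$, and $w\models_I\Diamond\psi[\vec a/\vec x]$ iff there are $u\in R_0[w]$ and $b_i\in R[a_i]\cap\pi^{ -1}(u)$ with $a_i=a_j\Rightarrow b_i=b_j$ such that $u\models_I\psi[\vec b/\vec x]$. -}

module Defs where

open import Data.Nat using (ℕ)
open import Data.Bool using (Bool; true; false; _∨_)
open import Data.Maybe using (Maybe; just; nothing)
open import Data.Product using (Σ; ∃; ∃-syntax; _×_; _,_)
open import Data.Sum using (_⊎_)
open import Data.Empty using (⊥)
open import Relation.Nullary using (¬_)
open import Relation.Binary using (IsEquivalence)
open import Relation.Binary.PropositionalEquality using (_≡_)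

Letter : Set
Letter = ℕ

record MKFrame : Set₁ where
  field
    X        : Set
    inhabited : X
    R        : X → X → Set
    E        : X → X → Set
    E-equiv  : IsEquivalence E
    mk-cond  : ∀ {x y z} → E x y → R y z → ∃[ u ] (R x u × E u z)

data Fm : Set where
  var  : Letter → Fm
  neg  : Fm → Fm
  or   : Fm → Fm → Fm
  dia  : Fm → Fm
  ex   : Fm → Fm

FValuation : MKFrame → Set₁
FValuation F = Letter → MKFrame.X F → Set

_,_⊨F_[_] : (F : MKFrame) → FValuation F → Fm → MKFrame.X F → Set
F , v ⊨F var p   [ a ] = v p a
F , v ⊨F neg φ   [ a ] = ¬ (F , v ⊨F φ [ a ])
F , v ⊨F or φ ψ  [ a ] = (F , v ⊨F φ [ a ]) ⊎ (F , v ⊨F ψ [ a ])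
F , v ⊨F dia φ   [ a ] = ∃[ b ] (MKFrame.R F a b × F , v ⊨F φ [ b ])
F , v ⊨F ex φ    [ a ] = ∃[ b ] (MKFrame.E F a b × F , v ⊨F φ [ b ])

-- The quotient X/E, presented as any type W with a surjection π : X → W
-- whose kernel is exactly E (quotients are unique up to bijection).

record QuotientOf (F : MKFrame) : Set₁ where
  open MKFrame F
  field
    W      : Set
    π      : X → W
    π-surj : ∀ w → ∃[ a ] (π a ≡ w)
    π-eq   : ∀ {a b} → π a ≡ π b → E a b
    eq-π   : ∀ {a b} → E a b → π a ≡ π b

R₀ : (F : MKFrame) (Q : QuotientOf F) → QuotientOf.W Q → QuotientOf.W Q → Set
R₀ F Q w u = ∃[ x ] ∃[ y ] ∃[ z ]
  (π x ≡ w × π y ≡ u × R x z × E z y)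
  where open MKFrame F
        open QuotientOf Q

-- One-variable first-order modal language with unary predicates p*
-- (p a letter) and the single individual variable x.

data BFm : Set where
  P*   : Letter → BFm
  bneg : BFm → BFm
  bor  : BFm → BFm → BFm
  bdia : BFm → BFm
  bex  : BFm → BFm

xFree : BFm → Bool
xFree (P* p)    = true
xFree (bneg ψ)  = xFree ψ
xFree (bor ψ χ) = xFree ψ ∨ xFree χ
xFree (bdia ψ)  = xFree ψ
xFree (bex ψ)   = false

record BValuation (F : MKFrame) (Q : QuotientOf F) : Set₁ where
  open MKFrame F
  open QuotientOf Q
  field
    I       : Letter → W → X → Set
    I-fibre : ∀ {p w a} → I p w a → π a ≡ w

-- assignment of x: 'just a' means x ↦ a; 'nothing' means no free variable.
-- Witness data for the ◇-clause: for each free variable (here at most x)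
-- with value a, a value b ∈ R[a] ∩ π⁻¹(u).
DiaLift : (F : MKFrame) (Q : QuotientOf F) → BFm → Maybe (MKFrame.X F)
        → Maybe (MKFrame.X F) → QuotientOf.W Q → Set
DiaLift F Q ψ g g' u with xFree ψ
... | true  = ∃[ a ] ∃[ b ] (g ≡ just a × g' ≡ just b × R a b × π b ≡ u)
  where open MKFrame F
        open QuotientOf Q
... | false = g' ≡ nothing

sat : (F : MKFrame) (Q : QuotientOf F) → BValuation F Q
    → QuotientOf.W Q → BFm → Maybe (MKFrame.X F) → Set
sat F Q I w (P* p)    (just a) = BValuation.I I p w a
sat F Q I w (P* p)    nothing  = ⊥
sat F Q I w (bneg ψ)  g = ¬ sat F Q I w ψ g
sat F Q I w (bor ψ χ) g = sat F Q I w ψ g ⊎ sat F Q I w χ g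
sat F Q I w (bdia ψ)  g =
  ∃[ u ] (R₀ F Q w u × ∃[ g' ] (DiaLift F Q ψ g g' u × sat F Q I u ψ g'))
sat F Q I w (bex ψ)   g =
  ∃[ b ] (QuotientOf.π Q b ≡ w × sat F Q I w ψ (just b))

_ᵗ : Fm → BFm
var p ᵗ  = P* p
neg φ ᵗ  = bneg (φ ᵗ)
or φ ψ ᵗ = bor (φ ᵗ) (ψ ᵗ)
dia φ ᵗ  = bdia (φ ᵗ)
ex φ ᵗ   = bex (φ ᵗ)

_⊨B_[_] : {F : MKFrame} {Q : QuotientOf F} → BValuation F Q → Fm → MKFrame.X F → Set
_⊨B_[_] {F} {Q} I φ a = sat F Q I (QuotientOf.π Q a) (φ ᵗ) (just a)

{-# OPTIONS --safe #-}
-- The bundle semantics of ◇ and ∃x at the variable x matches the frame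
-- semantics of ◇ and ∃: an E-neighbour of a is an element of the fibre over
-- π a, and an R-successor of a is a lift along π of an R₀-step from π a. The
-- one delicate case is ◇ψ with x not free in ψ, where the bundle only asks for
-- some R₀-successor world of π a; the MK-condition lifts that world to an
-- R-successor of a itself. So valuations agreeing on letters (p against p*)
-- agree on all translated formulas, and each kind of valuation induces an
-- agreeing one of the other kind.
module Submission where

open import Defs
open import Data.Bool using (true; false)
open import Data.Bool.Properties using (∨-conicalˡ; ∨-conicalʳ)
open import Data.Maybe using (just; nothing)
open import Data.Product using (Σ; ∃-syntax; _×_; _,_; proj₁; <_,_>)
open import Data.Product.Function.Dependent.Propositional using (congˡ)
open import Data.Product.Function.NonDependent.Propositional using (_×-⇔_)
open import Data.Sum using (inj₁; inj₂)
open import Data.Sum.Function.Propositional using (_⊎-⇔_)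
open import Function.Bundles using (_⇔_; mk⇔; Equivalence)
open import Function.Related.Propositional using (equivalence)
open import Function.Related.TypeIsomorphisms using (¬-cong-⇔)
import Function.Properties.Equivalence as ⇔
open import Relation.Binary using (IsEquivalence)
open import Relation.Binary.PropositionalEquality using (_≡_; refl; sym; subst)

module _ {F : MKFrame} {Q : QuotientOf F} where
  open MKFrame F
  open QuotientOf Q
  private module E = IsEquivalence E-equiv

  R₀-intro : ∀ {a b} → R a b → R₀ F Q (π a) (π b)
  R₀-intro {a} {b} aRb = a , b , b , refl , refl , aRb , E.refl

  R₀-lift : ∀ {a u} → R₀ F Q (π a) u → ∃[ b ] (R a b × π b ≡ u)
  R₀-lift (x , y , z , πx≡πa , refl , xRz , zEy) with mk-cond (π-eq (sym πx≡πa)) xRz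
  ... | b , aRb , bEz = b , aRb , eq-π (E.trans bEz zEy)

  module _ (I : BValuation F Q) where

    sat-closed : ∀ ψ → xFree ψ ≡ false → ∀ {w} g g′ → sat F Q I w ψ g → sat F Q I w ψ g′
    sat-closed (P* p)    ()
    sat-closed (bneg ψ)  closed g g′ ¬s s′ = ¬s (sat-closed ψ closed g′ g s′)
    sat-closed (bor ψ χ) closed g g′ (inj₁ s) = inj₁ (sat-closed ψ (∨-conicalˡ _ _ closed) g g′ s)
    sat-closed (bor ψ χ) closed g g′ (inj₂ s) = inj₂ (sat-closed χ (∨-conicalʳ _ _ closed) g g′ s)
    sat-closed (bdia ψ)  closed g g′ s rewrite closed = s
    sat-closed (bex ψ)   closed g g′ s = s

    sat-ex : ∀ ψ a →
             sat F Q I (π a) (bex ψ) (just a) ⇔ (∃[ b ] (E a b × sat F Q I (π b) ψ (just b)))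
    sat-ex ψ a = mk⇔
      (λ (b , πb≡πa , s) → b , π-eq (sym πb≡πa) , transport (sym πb≡πa) s)
      (λ (b , aEb , s) → b , sym (eq-π aEb) , transport (sym (eq-π aEb)) s)
      where
      transport : ∀ {b w w′} → w ≡ w′ → sat F Q I w ψ (just b) → sat F Q I w′ ψ (just b)
      transport {b} = subst (λ w → sat F Q I w ψ (just b))

    sat-dia : ∀ ψ a →
              sat F Q I (π a) (bdia ψ) (just a) ⇔ (∃[ b ] (R a b × sat F Q I (π b) ψ (just b)))
    sat-dia ψ a with xFree ψ in closed
    ... | true = mk⇔
      (λ { (_ , _ , _ , (_ , b , refl , refl , aRb , refl) , s) → b , aRb , s })
      (λ (b , aRb , s) → π b , R₀-intro aRb , just b , (a , b , refl , refl , aRb , refl) , s)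
    ... | false = mk⇔
      (λ { (_ , πa↝u , _ , refl , s) → at-lift (R₀-lift πa↝u) s })
      (λ (b , aRb , s) → π b , R₀-intro aRb , nothing , refl , sat-closed ψ closed (just b) nothing s)
      where
      at-lift : ∀ {u} → ∃[ b ] (R a b × π b ≡ u) → sat F Q I u ψ nothing
              → ∃[ b ] (R a b × sat F Q I (π b) ψ (just b))
      at-lift (b , aRb , refl) s = b , aRb , sat-closed ψ closed nothing (just b) s

  Agree : BValuation F Q → FValuation F → Set
  Agree I v = ∀ p a → (I ⊨B var p [ a ]) ⇔ (F , v ⊨F var p [ a ])

  translation : ∀ {I v} → Agree I v → ∀ φ a → (I ⊨B φ [ a ]) ⇔ (F , v ⊨F φ [ a ])
  translation agree (var p)  a = agree p a
  translation agree (neg φ)  a = ¬-cong-⇔ (translation agree φ a)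
  translation agree (or φ ψ) a = translation agree φ a ⊎-⇔ translation agree ψ a
  translation {I} agree (dia φ) a =
    ⇔.trans (sat-dia I (φ ᵗ) a) (congˡ {k = equivalence} (⇔.refl ×-⇔ translation agree φ _))
  translation {I} agree (ex φ) a =
    ⇔.trans (sat-ex I (φ ᵗ) a) (congˡ {k = equivalence} (⇔.refl ×-⇔ translation agree φ _))

  toBValuation : FValuation F → BValuation F Q
  toBValuation v = record { I = λ p w a → v p a × π a ≡ w ; I-fibre = λ (_ , πa≡w) → πa≡w }

  toBValuation-agrees : ∀ v → Agree (toBValuation v) v
  toBValuation-agrees v p a = mk⇔ proj₁ (_, refl)

  toFValuation : BValuation F Q → FValuation F
  toFValuation I p a = BValuation.I I p (π a) a

  toFValuation-agrees : ∀ I → Agree I (toFValuation I)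
  toFValuation-agrees I p a = ⇔.refl

lemma5p2 : (F : MKFrame) (Q : QuotientOf F)
    → ((v : FValuation F) → Σ (BValuation F Q) λ I → ((φ : Fm) (a : MKFrame.X F)
          → ((I ⊨B φ [ a ]) → (F , v ⊨F φ [ a ])) × ((F , v ⊨F φ [ a ]) → (I ⊨B φ [ a ]))))
    × ((I : BValuation F Q) → ∃[ v ] ((φ : Fm) (a : MKFrame.X F)
          → ((I ⊨B φ [ a ]) → (F , v ⊨F φ [ a ])) × ((F , v ⊨F φ [ a ]) → (I ⊨B φ [ a ]))))
lemma5p2 F Q =
  (λ v → toBValuation v , both-ways (toBValuation-agrees {Q = Q} v)) ,
  (λ I → toFValuation I , both-ways (toFValuation-agrees I))
  where
  both-ways : ∀ {I v} → Agree I v → ∀ φ a →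
              ((I ⊨B φ [ a ]) → (F , v ⊨F φ [ a ])) × ((F , v ⊨F φ [ a ]) → (I ⊨B φ [ a ]))
  both-ways agree φ a = < Equivalence.to , Equivalence.from > (translation agree φ a)
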